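{- Let $\mathbb{F}$ be a finite field, $d\geq 1$ and $n_1,\dots,n_d$ positive integers. Let $Q$ be a $k$-system and, for every non-empty $I\subset [d]$, let $L_I\subset \mathbb{F}^{I}$ be a subspace of codimension at most $l$. Let $T=\bigcap_{\emptyset\neq I\subset[d]}(L_I\otimes \mathbb{F}^{I^c})$. Then $Q\cap T$ contains an $f$-system for $f=k+2^dl$.
   Context: For $I\subset[d]$, $\mathbb{F}^I=\bigotimes_{i\in I}\mathbb{F}^{n_i}$, $I^c=[d]\setminus I$, $\mathbb{F}^{\emptyset}=\mathbb{F}$, and $L_I\otimes\mathbb{F}^{I^c}$ is viewed as a subspace of $\mathbb{F}^{n_1}\otimes\dots\otimes\mathbb{F}^{n_d}$. An $l$-system: take a subspace $U\subset\mathbb{F}^{n_1}$ of codimension at most $l$, and for every $2\leq j\leq d$ and every $u_1\in U,u_2\in U_{u_1},\dots,u_{j-1}\in U_{u_1,\dots,u_{j-2}}$ a subspace $U_{u_1,\dots,u_{j-1}}\subset\mathbb{F}^{n_j}$ of codimension at most $l$; the multiset $\{u_1\otimes\dots\otimes u_d: u_1\in U,\dots,u_d\in U_{u_1,\dots,u_{d-1}}\}$ (one element per tuple) is an $l$-system. -}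

module Defs where

open import Level using (0ℓ)
open import Algebra.Bundles using (CommutativeRing)
open import Data.Bool using (Bool; true; false; T; not)
open import Data.Nat using (ℕ; zero; suc)
open import Data.Fin using (Fin)
open import Data.Vec using (Vec; []; _∷_; lookup)
open import Data.Fin.Subset using (Subset; Nonempty; ∁; ⊤)
open import Data.Product using (Σ; Σ-syntax; ∃; _×_; _,_)
open import Data.List using (List; []; _∷_)
open import Data.Unit using () renaming (⊤ to Unit; tt to unit)
open import Relation.Nullary using (¬_)
open import Relation.Binary.PropositionalEquality using (_≡_; _≗_)
open import Function.Bundles using (_↔_)
open import Function.Definitions using (Injective)

-- The standard library has no Field bundle, so a field
-- is a commutative ring with 0 ≠ 1 and inverses of non-zero elements.
-- We additionally require the ring's setoid equality to be propositional
-- equality (every finite field is isomorphic to one of this form) and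
-- finiteness of the carrier.

record FiniteField : Set₁ where
  field
    commRing  : CommutativeRing 0ℓ 0ℓ
  open CommutativeRing commRing public
  field
    ≈⇒≡       : ∀ {x y} → x ≈ y → x ≡ y
    0≢1       : ¬ (0# ≈ 1#)
    inverse   : ∀ x → ¬ (x ≈ 0#) → ∃ λ y → x * y ≈ 1#
    size      : ℕ
    finite    : Carrier ↔ Fin size

module _ (F : FiniteField) where
  open FiniteField F

  ΣFin : (l : ℕ) → (Fin l → Carrier) → Carrier
  ΣFin zero    f = 0#
  ΣFin (suc l) f = f Fin.zero + ΣFin l (λ i → f (Fin.suc i))

  -- Membership is
  -- Bool-valued (subspaces of a finite space are decidable), so that each
  -- vector is counted at most once in the index set of a system.
  record SubspaceV (n : ℕ) : Set where
    field
      mem      : Vec Carrier n → Bool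
      zero-mem : T (mem (Data.Vec.replicate n 0#))
      +-mem    : ∀ u v → T (mem u) → T (mem v) → T (mem (Data.Vec.zipWith _+_ u v))
      *-mem    : ∀ c u → T (mem u) → T (mem (Data.Vec.map (c *_) u))

  -- codim U ≤ l : F^n / U is spanned by (the images of) l vectors.
  CodimV≤ : ∀ {n} → SubspaceV n → ℕ → Set
  CodimV≤ {n} U l =
    Σ[ w ∈ (Fin l → Vec Carrier n) ]
      ∀ (v : Vec Carrier n) → Σ[ c ∈ (Fin l → Carrier) ]
        T (SubspaceV.mem U
            (Data.Vec.tabulate (λ p → lookup v p - ΣFin l (λ i → c i * lookup (w i) p))))

  record SubspaceF (A : Set) : Set₁ where
    field
      mem      : (A → Carrier) → Set
      resp     : ∀ {x y} → x ≗ y → mem x → mem y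
      zero-mem : mem (λ _ → 0#)
      +-mem    : ∀ x y → mem x → mem y → mem (λ a → x a + y a)
      *-mem    : ∀ c x → mem x → mem (λ a → c * x a)

  CodimF≤ : ∀ {A} → SubspaceF A → ℕ → Set
  CodimF≤ {A} U l =
    Σ[ w ∈ (Fin l → A → Carrier) ]
      ∀ (v : A → Carrier) → Σ[ c ∈ (Fin l → Carrier) ]
        SubspaceF.mem U (λ a → v a - ΣFin l (λ i → c i * w i a))

  -- Multi-indices.  For dims ns = (n_1,…,n_d) and I ⊆ [d], Idx I ns is the
  -- index set ∏_{i∈I} [n_i]; F^I = Idx I ns → F.  Full tensor space:
  -- Idx ⊤ ns → F = F^{n_1} ⊗ … ⊗ F^{n_d}.

  Idx : ∀ {d} → Subset d → Vec ℕ d → Set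
  Idx []           []       = Unit
  Idx (true ∷ I)   (n ∷ ns) = Fin n × Idx I ns
  Idx (false ∷ I)  (n ∷ ns) = Idx I ns

  restrict : ∀ {d} (I : Subset d) (ns : Vec ℕ d) → Idx ⊤ ns → Idx I ns
  restrict []          []       _        = unit
  restrict (true ∷ I)  (n ∷ ns) (i , is) = i , restrict I ns is
  restrict (false ∷ I) (n ∷ ns) (i , is) = restrict I ns is

  Tensor : ∀ {d} → Vec ℕ d → Set
  Tensor {d} ns = Idx {d} ⊤ ns → Carrier

  tensorI : ∀ {d} {ns : Vec ℕ d} (I : Subset d) → (Idx I ns → Carrier) →
            (Idx (∁ I) ns → Carrier) → Tensor ns
  tensorI {ns = ns} I x y = λ i → x (restrict I ns i) * y (restrict (∁ I) ns i)

  sumT : ∀ {d} {ns : Vec ℕ d} → List (Tensor ns) → Tensor ns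
  sumT []       = λ _ → 0#
  sumT {ns = ns} (t ∷ ts) = λ i → t i + sumT {ns = ns} ts i

  InTensorSub : ∀ {d} {ns : Vec ℕ d} (I : Subset d) →
                SubspaceF (Idx I ns) → Tensor ns → Set
  InTensorSub {ns = ns} I L t =
    Σ[ xs ∈ List (Σ[ x ∈ (Idx I ns → Carrier) ] (SubspaceF.mem L x × (Idx (∁ I) ns → Carrier))) ]
      t ≗ sumT {ns = ns} (Data.List.map (λ { (x , _ , y) → tensorI {ns = ns} I x y }) xs)

  InT : ∀ {d} {ns : Vec ℕ d} → ((I : Subset d) → SubspaceF (Idx I ns)) → Tensor ns → Set
  InT {d} L t = ∀ (I : Subset d) → Nonempty I → InTensorSub I (L I) t

  -- l-systems.  A system for dims (n_j, …, n_d): a subspace U ⊆ F^{n_j} of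
  -- codim ≤ l, and for every u a system for (n_{j+1}, …, n_d) (only the
  -- children of u ∈ U are ever used).
  System : ∀ {d} → ℕ → Vec ℕ d → Set
  System l []       = Unit
  System l (n ∷ ns) = Σ[ U ∈ SubspaceV n ] (CodimV≤ U l × (Vec Carrier n → System l ns))

  -- Index set of the multiset: the tuples (u_1,…,u_d) with u_j ∈ U_{u_1…u_{j-1}}.
  Tuples : ∀ {d l} (ns : Vec ℕ d) → System l ns → Set
  Tuples []       _            = Unit
  Tuples (n ∷ ns) (U , _ , ch) =
    Σ[ u ∈ Vec Carrier n ] (T (SubspaceV.mem U u) × Tuples ns (ch u))

  pure : ∀ {d l} (ns : Vec ℕ d) (S : System l ns) → Tuples ns S → Tensor ns
  pure []       _            _             _        = 1#
  pure (n ∷ ns) (U , _ , ch) (u , _ , ts) (i , is) = lookup u i * pure ns (ch u) ts is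

  SubMultiset : ∀ {d l m} (ns : Vec ℕ d) → System l ns → System m ns → Set
  SubMultiset ns P Q =
    Σ[ ι ∈ (Tuples ns P → Tuples ns Q) ]
      (Injective _≡_ _≡_ ι × (∀ t → pure ns Q (ι t) ≗ pure ns P t))

{-# OPTIONS --safe #-}
module Submission where

-- Each L_I of codimension ≤ l contains the common kernel of l linear forms on F^I, so u₁ ⊗ ⋯ ⊗ u_d
-- lies in T as soon as the 2^d·l multilinear conditions ⟨c , ⊗_{j∈I} u_j⟩ = 0 hold. Such a condition
-- is imposed while the vectors are chosen coordinate by coordinate: once u_j is fixed for the
-- coordinates j ∈ I below the last one, i, it is a single linear condition on u_i, met by shrinking
-- U_{u₁…u_{i−1}} by one codimension. Reserving one codimension for every condition at every level
-- turns the k-system into a (k + 2^d·l)-system.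

open import Defs
open import Data.Bool using (T; true; false)
open import Data.Bool.Properties using (T?; T-irrelevant)
open import Data.Fin using (Fin; zero; suc; remQuot; combine; finToFun; funToFin)
open import Data.Fin.Properties using (all?; ¬∀⟶∃¬; 2↔Bool; remQuot-combine; finToFun-funToFin)
import Data.Fin.Properties as Fin
open import Data.Fin.Subset using (Subset; Nonempty; ⊤; ∁)
open import Data.Fin.Subset.Properties using (nonempty?)
open import Data.List using ([_])
open import Data.Nat as ℕ using (ℕ; zero; suc)
import Data.Nat.Properties as ℕₚ
open import Data.Product using (Σ-syntax; _×_; _,_; proj₁; proj₂; map₁)
open import Data.Product.Properties.WithK using (,-injectiveʳ)
open import Data.Unit using (tt) renaming (⊤ to Unit)
open import Data.Vec using (Vec; []; _∷_; here; there; lookup; tabulate; replicate; zipWith; map)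
open import Data.Vec.Properties
  using (lookup∘tabulate; tabulate∘lookup; tabulate-cong; lookup-replicate; lookup-zipWith; lookup-map)
open import Function using (Inverse; _∘_)
open import Function.Definitions using (Injective)
open import Function.Properties.Inverse using (Inverse⇒Injection)
open import Relation.Binary using (Decidable)
open import Relation.Binary.PropositionalEquality using (_≡_; _≗_)
import Relation.Binary.PropositionalEquality as ≡
open import Relation.Nullary using (¬_; Dec; yes; no; contradiction)
open import Relation.Nullary.Decidable using (⌊_⌋; toWitness; fromWitness; _×-dec_; map′; via-injection)
open import Relation.Unary using () renaming (Decidable to Decidable₁)

subsetAt : ∀ {d} → Fin (2 ℕ.^ d) → Subset d
subsetAt j = tabulate (Inverse.to 2↔Bool ∘ finToFun j)

indexOf : ∀ {d} → Subset d → Fin (2 ℕ.^ d)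
indexOf I = funToFin (Inverse.from 2↔Bool ∘ lookup I)

subsetAt-indexOf : ∀ {d} (I : Subset d) → subsetAt (indexOf I) ≡ I
subsetAt-indexOf I = ≡.trans (tabulate-cong bit) (tabulate∘lookup I)
  where
  bit : ∀ i → Inverse.to 2↔Bool (finToFun (indexOf I) i) ≡ lookup I i
  bit i = ≡.trans (≡.cong (Inverse.to 2↔Bool) (finToFun-funToFin _ i))
                  (Inverse.strictlyInverseˡ 2↔Bool (lookup I i))

subsetAndIndex : ∀ {d l} → Fin (2 ℕ.^ d ℕ.* l) → Subset d × Fin l
subsetAndIndex {d} {l} j = map₁ subsetAt (remQuot {2 ℕ.^ d} l j)

subsetAndIndex-surjective : ∀ {d l} (I : Subset d) (i : Fin l) →
                            Σ[ j ∈ Fin (2 ℕ.^ d ℕ.* l) ] subsetAndIndex j ≡ (I , i)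
subsetAndIndex-surjective I i =
  combine (indexOf I) i ,
  ≡.trans (≡.cong (map₁ subsetAt) (remQuot-combine (indexOf I) i))
          (≡.cong (_, i) (subsetAt-indexOf I))

module _ (F : FiniteField) where
  open FiniteField F hiding (zero)
  open import Relation.Binary.Reasoning.Setoid setoid
  open import Algebra.Properties.Ring ring
    using (-0#≈0#; -‿+-comm; -‿distribˡ-*; -1*x≈-x; x[y-z]≈xy-xz)
  open import Algebra.Properties.CommutativeSemigroup *-commutativeSemigroup
    using (x∙yz≈y∙xz; x∙yz≈yx∙z)
  open import Algebra.Properties.CommutativeSemigroup +-commutativeSemigroup
    using () renaming (interchange to +-interchange)

  infix 4 _≈?_
  _≈?_ : Decidable _≈_
  x ≈? y = map′ reflexive ≈⇒≡ (via-injection (Inverse⇒Injection finite) Fin._≟_ x y)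

  infixr 7 _∩_
  _∩_ : ∀ {A} → SubspaceF F A → SubspaceF F A → SubspaceF F A
  S ∩ S′ = record
    { mem      = λ x → S.mem x × S′.mem x
    ; resp     = λ e (x∈S , x∈S′) → S.resp e x∈S , S′.resp e x∈S′
    ; zero-mem = S.zero-mem , S′.zero-mem
    ; +-mem    = λ x y (x∈S , x∈S′) (y∈S , y∈S′) →
                   S.+-mem x y x∈S y∈S , S′.+-mem x y x∈S′ y∈S′
    ; *-mem    = λ c x (x∈S , x∈S′) → S.*-mem c x x∈S , S′.*-mem c x x∈S′
    }
    where
    module S  = SubspaceF S
    module S′ = SubspaceF S′

  −*-mem : ∀ {A} (S : SubspaceF F A) {x y : A → Carrier} c →
         SubspaceF.mem S x → SubspaceF.mem S y → SubspaceF.mem S (λ a → x a - c * y a)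
  −*-mem S {x} {y} c x∈S y∈S =
    S.resp (λ a → ≈⇒≡ (+-congˡ (sym (-‿distribˡ-* c (y a)))))
      (S.+-mem x _ x∈S (S.*-mem (- c) y y∈S))
    where module S = SubspaceF S

  ΣFin-cong : ∀ m {f g : Fin m → Carrier} → (∀ i → f i ≈ g i) → ΣFin F m f ≈ ΣFin F m g
  ΣFin-cong zero    e = refl
  ΣFin-cong (suc m) e = +-cong (e zero) (ΣFin-cong m (e ∘ suc))

  ΣFin-0 : ∀ m → ΣFin F m (λ _ → 0#) ≈ 0#
  ΣFin-0 zero    = refl
  ΣFin-0 (suc m) = trans (+-identityˡ _) (ΣFin-0 m)

  ΣFin-+ : ∀ m (f g : Fin m → Carrier) → ΣFin F m (λ i → f i + g i) ≈ ΣFin F m f + ΣFin F m g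
  ΣFin-+ zero    f g = sym (+-identityʳ 0#)
  ΣFin-+ (suc m) f g = trans (+-congˡ (ΣFin-+ m (f ∘ suc) (g ∘ suc))) (+-interchange _ _ _ _)

  ΣFin-* : ∀ m c (f : Fin m → Carrier) → ΣFin F m (λ i → c * f i) ≈ c * ΣFin F m f
  ΣFin-* zero    c f = sym (zeroʳ c)
  ΣFin-* (suc m) c f = trans (+-congˡ (ΣFin-* m c (f ∘ suc))) (sym (distribˡ c _ _))

  ΣFin-closed : ∀ m {B : Set} (S : SubspaceF F B) (g : Fin m → B → Carrier) →
                (∀ i → SubspaceF.mem S (g i)) → SubspaceF.mem S (λ b → ΣFin F m (λ i → g i b))
  ΣFin-closed zero    S g g∈S = SubspaceF.zero-mem S
  ΣFin-closed (suc m) S g g∈S =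
    SubspaceF.+-mem S _ _ (g∈S zero) (ΣFin-closed m S (g ∘ suc) (g∈S ∘ suc))

  δFin : ∀ {m} → Fin m → Fin m → Carrier
  δFin zero    zero    = 1#
  δFin zero    (suc _) = 0#
  δFin (suc _) zero    = 0#
  δFin (suc i) (suc j) = δFin i j

  record Summable (A : Set) : Set₁ where
    field
      ∑        : (A → Carrier) → Carrier
      ∑-cong   : ∀ {f g : A → Carrier} → (∀ a → f a ≈ g a) → ∑ f ≈ ∑ g
      ∑-+      : ∀ (f g : A → Carrier) → ∑ (λ a → f a + g a) ≈ ∑ f + ∑ g
      ∑-*      : ∀ c (f : A → Carrier) → ∑ (λ a → c * f a) ≈ c * ∑ f
      δ        : A → A → Carrier
      ∑-δ      : ∀ (f : A → Carrier) b → ∑ (λ a → f a * δ a b) ≈ f b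
      ∑-closed : ∀ {B : Set} (S : SubspaceF F B) (g : A → B → Carrier) →
                 (∀ a → SubspaceF.mem S (g a)) → SubspaceF.mem S (λ b → ∑ (λ a → g a b))

    ∑-0 : ∑ (λ _ → 0#) ≈ 0#
    ∑-0 = begin
      ∑ (λ _ → 0#)       ≈⟨ ∑-cong (λ _ → sym (zeroˡ 0#)) ⟩
      ∑ (λ _ → 0# * 0#)  ≈⟨ ∑-* 0# (λ _ → 0#) ⟩
      0# * ∑ (λ _ → 0#)  ≈⟨ zeroˡ _ ⟩
      0#                 ∎

    ∑-*ʳ : ∀ (f : A → Carrier) c → ∑ (λ a → f a * c) ≈ ∑ f * c
    ∑-*ʳ f c = trans (∑-cong (λ a → *-comm (f a) c)) (trans (∑-* c f) (*-comm c (∑ f)))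

    ∑-− : ∀ (f g : A → Carrier) → ∑ (λ a → f a - g a) ≈ ∑ f - ∑ g
    ∑-− f g = begin
      ∑ (λ a → f a - g a)             ≈⟨ ∑-+ f _ ⟩
      ∑ f + ∑ (λ a → - g a)           ≈⟨ +-congˡ (∑-cong (λ a → sym (-1*x≈-x (g a)))) ⟩
      ∑ f + ∑ (λ a → - 1# * g a)      ≈⟨ +-congˡ (∑-* (- 1#) g) ⟩
      ∑ f + - 1# * ∑ g                ≈⟨ +-congˡ (-1*x≈-x (∑ g)) ⟩
      ∑ f - ∑ g                       ∎

    ∑-ΣFin-swap : ∀ m (h : A → Fin m → Carrier) →
                  ∑ (λ a → ΣFin F m (h a)) ≈ ΣFin F m (λ i → ∑ (λ a → h a i))
    ∑-ΣFin-swap zero    h = ∑-0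
    ∑-ΣFin-swap (suc m) h = trans (∑-+ _ _) (+-congˡ (∑-ΣFin-swap m (λ a → h a ∘ suc)))

    infix 4 ⟪_∣_⟫
    ⟪_∣_⟫ : (A → Carrier) → (A → Carrier) → Carrier
    ⟪ φ ∣ x ⟫ = ∑ (λ a → φ a * x a)

    ⟪⟫-* : ∀ φ c x → ⟪ φ ∣ (λ a → c * x a) ⟫ ≈ c * ⟪ φ ∣ x ⟫
    ⟪⟫-* φ c x = trans (∑-cong (λ a → x∙yz≈y∙xz (φ a) c (x a))) (∑-* c _)

    ⟪⟫-−* : ∀ φ x c y → ⟪ φ ∣ (λ a → x a - c * y a) ⟫ ≈ ⟪ φ ∣ x ⟫ - c * ⟪ φ ∣ y ⟫
    ⟪⟫-−* φ x c y = begin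
      ∑ (λ a → φ a * (x a - c * y a))        ≈⟨ ∑-cong (λ a → x[y-z]≈xy-xz (φ a) _ _) ⟩
      ∑ (λ a → φ a * x a - φ a * (c * y a))  ≈⟨ ∑-− _ _ ⟩
      ⟪ φ ∣ x ⟫ - ⟪ φ ∣ (λ a → c * y a) ⟫     ≈⟨ +-congˡ (-‿cong (⟪⟫-* φ c y)) ⟩
      ⟪ φ ∣ x ⟫ - c * ⟪ φ ∣ y ⟫               ∎

    ker : (A → Carrier) → SubspaceF F A
    ker φ = record
      { mem      = λ x → ⟪ φ ∣ x ⟫ ≈ 0#
      ; resp     = λ e φx≈0 → trans (∑-cong (λ a → *-congˡ (reflexive (≡.sym (e a))))) φx≈0
      ; zero-mem = trans (∑-cong (λ a → zeroʳ (φ a))) ∑-0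
      ; +-mem    = λ x y φx≈0 φy≈0 → begin
          ∑ (λ a → φ a * (x a + y a))  ≈⟨ ∑-cong (λ a → distribˡ (φ a) (x a) (y a)) ⟩
          ∑ (λ a → φ a * x a + φ a * y a) ≈⟨ ∑-+ _ _ ⟩
          ⟪ φ ∣ x ⟫ + ⟪ φ ∣ y ⟫            ≈⟨ +-cong φx≈0 φy≈0 ⟩
          0# + 0#                       ≈⟨ +-identityʳ 0# ⟩
          0#                            ∎
      ; *-mem    = λ c x φx≈0 → trans (⟪⟫-* φ c x) (trans (*-congˡ φx≈0) (zeroʳ c))
      }

  unitSummable : Summable Unit
  unitSummable = record
    { ∑        = λ f → f tt
    ; ∑-cong   = λ e → e tt
    ; ∑-+      = λ f g → refl
    ; ∑-*      = λ c f → refl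
    ; δ        = λ _ _ → 1#
    ; ∑-δ      = λ f b → *-identityʳ (f b)
    ; ∑-closed = λ S g g∈S → g∈S tt
    }

  finSummable : ∀ m → Summable (Fin m)
  finSummable m = record
    { ∑        = ΣFin F m
    ; ∑-cong   = ΣFin-cong m
    ; ∑-+      = ΣFin-+ m
    ; ∑-*      = ΣFin-* m
    ; δ        = δFin
    ; ∑-δ      = sifting m
    ; ∑-closed = ΣFin-closed m
    }
    where
    sifting : ∀ m (f : Fin m → Carrier) b → ΣFin F m (λ a → f a * δFin a b) ≈ f b
    sifting (suc m) f zero = begin
      f zero * 1# + ΣFin F m (λ a → f (suc a) * 0#)
        ≈⟨ +-cong (*-identityʳ _) (ΣFin-cong m (λ a → zeroʳ (f (suc a)))) ⟩
      f zero + ΣFin F m (λ _ → 0#)                  ≈⟨ +-congˡ (ΣFin-0 m) ⟩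
      f zero + 0#                                   ≈⟨ +-identityʳ _ ⟩
      f zero                                        ∎
    sifting (suc m) f (suc b) = begin
      f zero * 0# + ΣFin F m (λ a → f (suc a) * δFin a b) ≈⟨ +-congʳ (zeroʳ _) ⟩
      0# + ΣFin F m (λ a → f (suc a) * δFin a b)          ≈⟨ +-identityˡ _ ⟩
      ΣFin F m (λ a → f (suc a) * δFin a b)               ≈⟨ sifting m (f ∘ suc) b ⟩
      f (suc b)                                           ∎

  infixr 2 _×ˢ_
  _×ˢ_ : ∀ {A B : Set} → Summable A → Summable B → Summable (A × B)
  _×ˢ_ {A} {B} X Y = record
    { ∑        = λ f → X.∑ (λ a → Y.∑ (λ b → f (a , b)))
    ; ∑-cong   = λ e → X.∑-cong (λ a → Y.∑-cong (λ b → e (a , b)))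
    ; ∑-+      = λ f g → trans (X.∑-cong (λ a → Y.∑-+ _ _)) (X.∑-+ _ _)
    ; ∑-*      = λ c f → trans (X.∑-cong (λ a → Y.∑-* c _)) (X.∑-* c _)
    ; δ        = δ×
    ; ∑-δ      = sifting
    ; ∑-closed = λ S g g∈S → X.∑-closed S _ (λ a → Y.∑-closed S _ (λ b → g∈S (a , b)))
    }
    where
    module X = Summable X
    module Y = Summable Y
    δ× : A × B → A × B → Carrier
    δ× (a , b) (a′ , b′) = X.δ a a′ * Y.δ b b′
    sifting : ∀ f ab → X.∑ (λ a → Y.∑ (λ b → f (a , b) * δ× (a , b) ab)) ≈ f ab
    sifting f (a′ , b′) = begin
      X.∑ (λ a → Y.∑ (λ b → f (a , b) * (X.δ a a′ * Y.δ b b′)))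
        ≈⟨ X.∑-cong (λ a → Y.∑-cong (λ b → x∙yz≈y∙xz _ _ _)) ⟩
      X.∑ (λ a → Y.∑ (λ b → X.δ a a′ * (f (a , b) * Y.δ b b′)))
        ≈⟨ X.∑-cong (λ a → Y.∑-* _ _) ⟩
      X.∑ (λ a → X.δ a a′ * Y.∑ (λ b → f (a , b) * Y.δ b b′))
        ≈⟨ X.∑-cong (λ a → trans (*-congˡ (Y.∑-δ _ b′)) (*-comm _ _)) ⟩
      X.∑ (λ a → f (a , b′) * X.δ a a′)
        ≈⟨ X.∑-δ _ a′ ⟩
      f (a′ , b′) ∎

  -- The codimension witness splits each basis vector δ p into residual p ∈ L and a combination of the
  -- complement vectors.
  module Residuals {A : Set} (X : Summable A) {L : SubspaceF F A} {l : ℕ} (cw : CodimF≤ F L l) where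
    open Summable X

    complement : Fin l → A → Carrier
    complement = proj₁ cw

    functional : Fin l → A → Carrier
    functional i p = proj₁ (proj₂ cw (δ p)) i

    residual : A → A → Carrier
    residual p b = δ p b - ΣFin F l (λ i → functional i p * complement i b)

    residual∈L : ∀ p → SubspaceF.mem L (residual p)
    residual∈L p = proj₂ (proj₂ cw (δ p))

    ρ : (A → Carrier) → A → Carrier
    ρ x b = ∑ (λ p → x p * residual p b)

    ρ∈L : ∀ x → SubspaceF.mem L (ρ x)
    ρ∈L x = ∑-closed L _ (λ p → SubspaceF.*-mem L (x p) (residual p) (residual∈L p))

    ρ≈ : ∀ x b → ρ x b ≈ x b - ΣFin F l (λ i → ⟪ functional i ∣ x ⟫ * complement i b)
    ρ≈ x b = begin
      ∑ (λ p → x p * (δ p b - ΣFin F l (λ i → functional i p * complement i b)))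
        ≈⟨ ∑-cong (λ p → x[y-z]≈xy-xz (x p) _ _) ⟩
      ∑ (λ p → x p * δ p b - x p * ΣFin F l (λ i → functional i p * complement i b))
        ≈⟨ ∑-− _ _ ⟩
      ∑ (λ p → x p * δ p b) - ∑ (λ p → x p * ΣFin F l (λ i → functional i p * complement i b))
        ≈⟨ +-cong (∑-δ x b) (-‿cong (∑-cong (λ p → sym (ΣFin-* l (x p) _)))) ⟩
      x b - ∑ (λ p → ΣFin F l (λ i → x p * (functional i p * complement i b)))
        ≈⟨ +-congˡ (-‿cong (∑-ΣFin-swap l _)) ⟩
      x b - ΣFin F l (λ i → ∑ (λ p → x p * (functional i p * complement i b)))
        ≈⟨ +-congˡ (-‿cong (ΣFin-cong l (λ i → trans (∑-cong (λ p → x∙yz≈yx∙z (x p) _ _))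
                                                    (∑-*ʳ _ (complement i b))))) ⟩
      x b - ΣFin F l (λ i → ⟪ functional i ∣ x ⟫ * complement i b) ∎

    ρ≈id : ∀ x → (∀ i → ⟪ functional i ∣ x ⟫ ≈ 0#) → ∀ b → ρ x b ≈ x b
    ρ≈id x φx≈0 b = begin
      ρ x b                                                          ≈⟨ ρ≈ x b ⟩
      x b - ΣFin F l (λ i → ⟪ functional i ∣ x ⟫ * complement i b)  ≈⟨ +-congˡ (-‿cong vanishes) ⟩
      x b - 0#                                                       ≈⟨ +-congˡ -0#≈0# ⟩
      x b + 0#                                                       ≈⟨ +-identityʳ (x b) ⟩
      x b                                                            ∎
      where
      vanishes : ΣFin F l (λ i → ⟪ functional i ∣ x ⟫ * complement i b) ≈ 0#
      vanishes = trans (ΣFin-cong l (λ i → trans (*-congʳ (φx≈0 i)) (zeroˡ _))) (ΣFin-0 l)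

    corrections⇒codim≤suc : {L′ : SubspaceF F A} (s : A → Carrier) →
                            (∀ x → Σ[ t ∈ Carrier ] SubspaceF.mem L′ (λ b → ρ x b - t * s b)) →
                            CodimF≤ F L′ (suc l)
    corrections⇒codim≤suc {L′} s corrected =
      w′ , λ x → c′ x , SubspaceF.resp L′ (≈⇒≡ ∘ rearrange x) (proj₂ (corrected x))
      where
      w′ : Fin (suc l) → A → Carrier
      w′ zero    = s
      w′ (suc i) = complement i
      c′ : (A → Carrier) → Fin (suc l) → Carrier
      c′ x zero    = proj₁ (corrected x)
      c′ x (suc i) = ⟪ functional i ∣ x ⟫
      rearrange : ∀ x b → ρ x b - c′ x zero * s b ≈ x b - ΣFin F (suc l) (λ i → c′ x i * w′ i b)
      rearrange x b = begin
        ρ x b - t * s b            ≈⟨ +-congʳ (ρ≈ x b) ⟩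
        (x b + - r) + - (t * s b)  ≈⟨ +-assoc _ _ _ ⟩
        x b + (- r + - (t * s b))  ≈⟨ +-congˡ (+-comm _ _) ⟩
        x b + (- (t * s b) + - r)  ≈⟨ +-congˡ (-‿+-comm _ _) ⟩
        x b - (t * s b + r)        ∎
        where
        t = c′ x zero
        r = ΣFin F l (λ i → ⟪ functional i ∣ x ⟫ * complement i b)

  codim≤⇒kernel⊆ : ∀ {A} (X : Summable A) {L : SubspaceF F A} {l} → CodimF≤ F L l →
    Σ[ φ ∈ (Fin l → A → Carrier) ] (∀ x → (∀ i → Summable.⟪_∣_⟫ X (φ i) x ≈ 0#) → SubspaceF.mem L x)
  codim≤⇒kernel⊆ X {L} cw =
    functional , λ x φx≈0 → SubspaceF.resp L (≈⇒≡ ∘ ρ≈id x φx≈0) (ρ∈L x)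
    where open Residuals X {L} cw

  codim≤-∩ker : ∀ {n m} {L : SubspaceF F (Fin n)} → CodimF≤ F L m → (φ : Fin n → Carrier) →
                CodimF≤ F (L ∩ Summable.ker (finSummable n) φ) (suc m)
  codim≤-∩ker {n} {L = L} cw φ = corrections⇒codim≤suc {L ∩ ker φ} (proj₁ correction) (proj₂ correction)
    where
    open Summable (finSummable n)
    open Residuals (finSummable n) {L} cw

    -- If φ kills every residual it kills every ρ x, and no correction is needed; otherwise a residual
    -- with ⟪ φ ∣ residual p₀ ⟫ ≠ 0, rescaled to s with ⟪ φ ∣ s ⟫ = 1, moves every ρ x into ker φ.
    correction : Σ[ s ∈ (Fin n → Carrier) ]
                 (∀ x → Σ[ t ∈ Carrier ] SubspaceF.mem (L ∩ ker φ) (λ b → ρ x b - t * s b))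
    correction with all? (λ p → ⟪ φ ∣ residual p ⟫ ≈? 0#)
    ... | yes φ⊥residuals =
      (λ _ → 0#) , λ x → 0# , −*-mem (L ∩ ker φ) 0# (ρ∈L x , ρ∈ker x) (SubspaceF.zero-mem (L ∩ ker φ))
      where
      ρ∈ker : ∀ x → ⟪ φ ∣ ρ x ⟫ ≈ 0#
      ρ∈ker x = ∑-closed (ker φ) _ (λ p → SubspaceF.*-mem (ker φ) (x p) (residual p) (φ⊥residuals p))
    ... | no ¬φ⊥residuals = s , λ x → ⟪ φ ∣ ρ x ⟫ , −*-mem L _ (ρ∈L x) s∈L , corrected∈ker x
      where
      nonzero : Σ[ p ∈ Fin n ] ¬ (⟪ φ ∣ residual p ⟫ ≈ 0#)
      nonzero = ¬∀⟶∃¬ n _ (λ p → ⟪ φ ∣ residual p ⟫ ≈? 0#) ¬φ⊥residuals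
      p₀ : Fin n
      p₀ = proj₁ nonzero
      z⁻¹ : Carrier
      z⁻¹ = proj₁ (inverse _ (proj₂ nonzero))
      s : Fin n → Carrier
      s b = z⁻¹ * residual p₀ b
      s∈L : SubspaceF.mem L s
      s∈L = SubspaceF.*-mem L _ _ (residual∈L p₀)
      φs≈1 : ⟪ φ ∣ s ⟫ ≈ 1#
      φs≈1 = trans (⟪⟫-* φ _ (residual p₀)) (trans (*-comm _ _) (proj₂ (inverse _ (proj₂ nonzero))))
      corrected∈ker : ∀ x → ⟪ φ ∣ (λ b → ρ x b - ⟪ φ ∣ ρ x ⟫ * s b) ⟫ ≈ 0#
      corrected∈ker x = begin
        ⟪ φ ∣ (λ b → ρ x b - t * s b) ⟫ ≈⟨ ⟪⟫-−* φ (ρ x) t s ⟩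
        t - t * ⟪ φ ∣ s ⟫               ≈⟨ +-congˡ (-‿cong (trans (*-congˡ φs≈1) (*-identityʳ t))) ⟩
        t - t                          ≈⟨ -‿inverseʳ t ⟩
        0#                             ∎
        where t = ⟪ φ ∣ ρ x ⟫

  infix 4 _∈ᵥ_
  _∈ᵥ_ : ∀ {n} → Vec Carrier n → SubspaceV F n → Set
  u ∈ᵥ U = T (SubspaceV.mem U u)

  ≡tabulate : ∀ {n} {v : Vec Carrier n} {g} → lookup v ≗ g → v ≡ tabulate g
  ≡tabulate {v = v} e = ≡.trans (≡.sym (tabulate∘lookup v)) (tabulate-cong e)

  asFunctions : ∀ {n} → SubspaceV F n → SubspaceF F (Fin n)
  asFunctions U = record
    { mem      = λ g → tabulate g ∈ᵥ U
    ; resp     = λ e → ≡.subst (_∈ᵥ U) (tabulate-cong e)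
    ; zero-mem = ≡.subst (_∈ᵥ U) (≡tabulate (λ i → lookup-replicate i 0#)) U.zero-mem
    ; +-mem    = λ g h g∈U h∈U → ≡.subst (_∈ᵥ U)
        (≡tabulate (λ i → ≡.trans (lookup-zipWith _+_ i (tabulate g) (tabulate h))
                                  (≡.cong₂ _+_ (lookup∘tabulate g i) (lookup∘tabulate h i))))
        (U.+-mem _ _ g∈U h∈U)
    ; *-mem    = λ c g g∈U → ≡.subst (_∈ᵥ U)
        (≡tabulate (λ i → ≡.trans (lookup-map i (c *_) (tabulate g)) (≡.cong (c *_) (lookup∘tabulate g i))))
        (U.*-mem c _ g∈U)
    }
    where module U = SubspaceV U

  subspaceV : ∀ {n} (S : SubspaceF F (Fin n)) → Decidable₁ (SubspaceF.mem S) → SubspaceV F n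
  subspaceV S S? = record
    { mem      = λ u → ⌊ S? (lookup u) ⌋
    ; zero-mem = fromS {replicate _ 0#} (S.resp (λ i → ≡.sym (lookup-replicate i 0#)) S.zero-mem)
    ; +-mem    = λ u v u∈S v∈S → fromS {zipWith _+_ u v}
        (S.resp (λ i → ≡.sym (lookup-zipWith _+_ i u v)) (S.+-mem _ _ (toS {u} u∈S) (toS {v} v∈S)))
    ; *-mem    = λ c u u∈S → fromS {map (c *_) u}
        (S.resp (λ i → ≡.sym (lookup-map i (c *_) u)) (S.*-mem c _ (toS {u} u∈S)))
    }
    where
    module S = SubspaceF S
    fromS : ∀ {u} → S.mem (lookup u) → T ⌊ S? (lookup u) ⌋
    fromS {u} = fromWitness {a? = S? (lookup u)}
    toS : ∀ {u} → T ⌊ S? (lookup u) ⌋ → S.mem (lookup u)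
    toS {u} = toWitness {a? = S? (lookup u)}

  ∈subspaceV⇒ : ∀ {n} {S : SubspaceF F (Fin n)} {S? u} → u ∈ᵥ subspaceV S S? → SubspaceF.mem S (lookup u)
  ∈subspaceV⇒ {S? = S?} {u} = toWitness {a? = S? (lookup u)}

  codimV⇒F : ∀ {n l} {U : SubspaceV F n} → CodimV≤ F U l → CodimF≤ F (asFunctions U) l
  codimV⇒F {l = l} {U} (w , cw) = (λ i → lookup (w i)) , λ g →
    proj₁ (cw (tabulate g)) ,
    ≡.subst (_∈ᵥ U) (tabulate-cong (λ p → ≡.cong (λ x → x - r g p) (lookup∘tabulate g p)))
            (proj₂ (cw (tabulate g)))
    where
    r : (Fin _ → Carrier) → Fin _ → Carrier
    r g p = ΣFin F l (λ i → proj₁ (cw (tabulate g)) i * lookup (w i) p)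

  codimF⇒V : ∀ {n l} {S : SubspaceF F (Fin n)} (S? : Decidable₁ (SubspaceF.mem S)) →
             CodimF≤ F S l → CodimV≤ F (subspaceV S S?) l
  codimF⇒V {l = l} {S} S? (w , cw) = (λ i → tabulate (w i)) , λ v →
    proj₁ (cw (lookup v)) ,
    fromWitness {a? = S? _} (SubspaceF.resp S (λ p → ≈⇒≡ (sym (entries v p))) (proj₂ (cw (lookup v))))
    where
    entries : ∀ v p →
      lookup (tabulate (λ q → lookup v q - ΣFin F l (λ i → proj₁ (cw (lookup v)) i * lookup (tabulate (w i)) q))) p
        ≈ lookup v p - ΣFin F l (λ i → proj₁ (cw (lookup v)) i * w i p)
    entries v p = trans (reflexive (lookup∘tabulate _ p))
                        (+-congˡ (-‿cong (ΣFin-cong l (λ i → *-congˡ (reflexive (lookup∘tabulate (w i) p))))))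

  module _ {n : ℕ} where
    open Summable (finSummable n) using (⟪_∣_⟫; ker)

    ∈∩ker? : ∀ U φ → Decidable₁ (SubspaceF.mem (asFunctions U ∩ ker φ))
    ∈∩ker? U φ g = T? _ ×-dec (⟪ φ ∣ g ⟫ ≈? 0#)

    infixl 7 _∩ker_
    _∩ker_ : SubspaceV F n → (Fin n → Carrier) → SubspaceV F n
    U ∩ker φ = subspaceV (asFunctions U ∩ ker φ) (∈∩ker? U φ)

    ∈∩ker⇒ : ∀ U φ {u} → u ∈ᵥ U ∩ker φ → u ∈ᵥ U × ⟪ φ ∣ lookup u ⟫ ≈ 0#
    ∈∩ker⇒ U φ {u} u∈ with ∈subspaceV⇒ {S = asFunctions U ∩ ker φ} {∈∩ker? U φ} {u} u∈
    ... | u∈U , φu≈0 = ≡.subst (_∈ᵥ U) (tabulate∘lookup u) u∈U , φu≈0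

    codimV≤-∩ker : ∀ {U m} → CodimV≤ F U m → ∀ φ → CodimV≤ F (U ∩ker φ) (suc m)
    codimV≤-∩ker {U} cw φ =
      codimF⇒V {S = asFunctions U ∩ ker φ} (∈∩ker? U φ) (codim≤-∩ker {L = asFunctions U} (codimV⇒F {U = U} cw) φ)

    ⋂ker : ∀ {N} → SubspaceV F n → (Fin N → Fin n → Carrier) → SubspaceV F n
    ⋂ker {zero}  U φs = U
    ⋂ker {suc N} U φs = ⋂ker U (φs ∘ suc) ∩ker φs zero

    ∈⋂ker⇒ : ∀ {N} U (φs : Fin N → Fin n → Carrier) {u} →
             u ∈ᵥ ⋂ker U φs → u ∈ᵥ U × (∀ j → ⟪ φs j ∣ lookup u ⟫ ≈ 0#)
    ∈⋂ker⇒ {zero}  U φs u∈ = u∈ , λ ()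
    ∈⋂ker⇒ {suc N} U φs u∈ with ∈∩ker⇒ (⋂ker U (φs ∘ suc)) (φs zero) u∈
    ... | u∈⋂ , φ₀u≈0 with ∈⋂ker⇒ U (φs ∘ suc) u∈⋂
    ...   | u∈U , φsu≈0 = u∈U , λ { zero → φ₀u≈0 ; (suc j) → φsu≈0 j }

    codimV≤-⋂ker : ∀ {N U m} → CodimV≤ F U m → (φs : Fin N → Fin n → Carrier) →
                   CodimV≤ F (⋂ker U φs) (N ℕ.+ m)
    codimV≤-⋂ker {zero}  cw φs = cw
    codimV≤-⋂ker {suc N} {U} cw φs = codimV≤-∩ker {⋂ker U (φs ∘ suc)} (codimV≤-⋂ker cw (φs ∘ suc)) (φs zero)

  idxSummable : ∀ {d} (I : Subset d) (ns : Vec ℕ d) → Summable (Idx F I ns)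
  idxSummable []          []       = unitSummable
  idxSummable (true ∷ I)  (n ∷ ns) = finSummable n ×ˢ idxSummable I ns
  idxSummable (false ∷ I) (n ∷ ns) = idxSummable I ns

  Vectors : ∀ {d} → Vec ℕ d → Set
  Vectors []       = Unit
  Vectors (n ∷ ns) = Vec Carrier n × Vectors ns

  ⨂ : ∀ {d} {ns : Vec ℕ d} (I : Subset d) → Vectors ns → Idx F I ns → Carrier
  ⨂ {ns = []}     []          _        _       = 1#
  ⨂ {ns = n ∷ ns} (true ∷ I)  (u , us) (q , p) = lookup u q * ⨂ I us p
  ⨂ {ns = n ∷ ns} (false ∷ I) (u , us) p       = ⨂ I us p

  ⨂⊤≈tensorI : ∀ {d} {ns : Vec ℕ d} (I : Subset d) (us : Vectors ns) i →
               ⨂ ⊤ us i ≈ tensorI F I (⨂ I us) (⨂ (∁ I) us) i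
  ⨂⊤≈tensorI {ns = []}     []          _        _       = sym (*-identityʳ 1#)
  ⨂⊤≈tensorI {ns = n ∷ ns} (true ∷ I)  (u , us) (q , i) =
    trans (*-congˡ (⨂⊤≈tensorI I us i)) (sym (*-assoc _ _ _))
  ⨂⊤≈tensorI {ns = n ∷ ns} (false ∷ I) (u , us) (q , i) =
    trans (*-congˡ (⨂⊤≈tensorI I us i)) (x∙yz≈y∙xz _ _ _)

  ⨂-empty : ∀ {d} {ns : Vec ℕ d} {I : Subset d} → ¬ Nonempty I → ∀ (us : Vectors ns) p → ⨂ I us p ≈ 1#
  ⨂-empty {ns = []}     {[]}        _  _        _ = refl
  ⨂-empty {ns = n ∷ ns} {true ∷ I}  ∅  _        _ = contradiction (zero , here) ∅
  ⨂-empty {ns = n ∷ ns} {false ∷ I} ∅  (u , us) p = ⨂-empty (λ (x , x∈I) → ∅ (suc x , there x∈I)) us p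

  vectorsOf : ∀ {d l} (ns : Vec ℕ d) (S : System F l ns) → Tuples F ns S → Vectors ns
  vectorsOf []       _            _            = tt
  vectorsOf (n ∷ ns) (_ , _ , ch) (u , _ , ts) = u , vectorsOf ns (ch u) ts

  pure≡⨂ : ∀ {d l} (ns : Vec ℕ d) (S : System F l ns) t → pure F ns S t ≗ ⨂ ⊤ (vectorsOf ns S t)
  pure≡⨂ []       _            _            _       = ≡.refl
  pure≡⨂ (n ∷ ns) (_ , _ , ch) (u , _ , ts) (q , i) = ≡.cong (lookup u q *_) (pure≡⨂ ns (ch u) ts i)

  data Constraint {d} (ns : Vec ℕ d) : Set where
    trivial : Constraint ns
    form    : (I : Subset d) → Nonempty I → (Idx F I ns → Carrier) → Constraint ns

  infix 4 _⊨_
  _⊨_ : ∀ {d} {ns : Vec ℕ d} → Vectors ns → Constraint ns → Set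
  us ⊨ trivial                  = Unit
  _⊨_ {ns = ns} us (form I _ c) = Summable.⟪_∣_⟫ (idxSummable I ns) c (⨂ I us) ≈ 0#

  ⊨-[] : (c : Constraint []) → tt ⊨ c
  ⊨-[] trivial            = tt
  ⊨-[] (form [] (() , _) _)

  nonempty-drop : ∀ {d} {I : Subset d} → Nonempty (false ∷ I) → Nonempty I
  nonempty-drop (suc x , there x∈I) = x , x∈I

  -- A form on I is due at the last coordinate of I, where it becomes a linear form in that vector
  -- (headForm); at an earlier coordinate of I it is contracted against the chosen vector and passed on.
  headForm : ∀ {n d} {ns : Vec ℕ d} → Constraint (n ∷ ns) → Fin n → Carrier
  headForm {ns = ns} (form (true ∷ I) _ c) with nonempty? I
  ... | yes _ = λ _ → 0#
  ... | no  _ = λ q → Summable.∑ (idxSummable I ns) (λ p → c (q , p))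
  headForm _ = λ _ → 0#

  specialise : ∀ {n d} {ns : Vec ℕ d} → Vec Carrier n → Constraint (n ∷ ns) → Constraint ns
  specialise {n} u (form (true ∷ I) _ c) with nonempty? I
  ... | yes I≠∅ = form I I≠∅ (λ p → ΣFin F n (λ q → lookup u q * c (q , p)))
  ... | no  _   = trivial
  specialise u (form (false ∷ I) I≠∅ c) = form I (nonempty-drop I≠∅) c
  specialise u trivial                  = trivial

  ⊨-∷ : ∀ {n d} {ns : Vec ℕ d} (con : Constraint (n ∷ ns)) {u us} →
        Summable.⟪_∣_⟫ (finSummable n) (headForm con) (lookup u) ≈ 0# → us ⊨ specialise u con →
        (u , us) ⊨ con
  ⊨-∷ trivial                _ _ = tt
  ⊨-∷ (form (false ∷ I) _ c) _ h = h
  ⊨-∷ {n} {ns = ns} (form (true ∷ I) _ c) {u} {us} h₁ h₂ with nonempty? I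
  ... | yes _ = begin
    ΣFin F n (λ q → ∑ (λ p → c (q , p) * (lookup u q * ⨂ I us p)))  ≈⟨ sym (∑-ΣFin-swap n _) ⟩
    ∑ (λ p → ΣFin F n (λ q → c (q , p) * (lookup u q * ⨂ I us p)))  ≈⟨ ∑-cong contract ⟩
    ∑ (λ p → ΣFin F n (λ q → lookup u q * c (q , p)) * ⨂ I us p)    ≈⟨ h₂ ⟩
    0#                                                              ∎
    where
    open Summable (idxSummable I ns)
    contract : ∀ p → ΣFin F n (λ q → c (q , p) * (lookup u q * ⨂ I us p))
                     ≈ ΣFin F n (λ q → lookup u q * c (q , p)) * ⨂ I us p
    contract p = trans (ΣFin-cong n (λ q → x∙yz≈yx∙z _ _ _)) (Summable.∑-*ʳ (finSummable n) _ _)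
  ... | no I=∅ = begin
    ΣFin F n (λ q → ∑ (λ p → c (q , p) * (lookup u q * ⨂ I us p)))
      ≈⟨ ΣFin-cong n (λ q → ∑-cong (λ p → *-congˡ (trans (*-congˡ (⨂-empty I=∅ us p)) (*-identityʳ _)))) ⟩
    ΣFin F n (λ q → ∑ (λ p → c (q , p) * lookup u q))
      ≈⟨ ΣFin-cong n (λ q → ∑-*ʳ _ _) ⟩
    ΣFin F n (λ q → ∑ (λ p → c (q , p)) * lookup u q)
      ≈⟨ h₁ ⟩
    0# ∎
    where open Summable (idxSummable I ns)

  subMultiset-[] : ∀ {l m} (P : System F l []) (Q : System F m []) → SubMultiset F {l = l} {m = m} [] P Q
  subMultiset-[] _ _ = (λ t → t) , (λ e → e) , (λ _ _ → ≡.refl)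

  subMultiset-∷ : ∀ {n d k m} {ns : Vec ℕ d} (P : System F m (n ∷ ns)) (Q : System F k (n ∷ ns)) →
                  (∀ {u} → u ∈ᵥ proj₁ P → u ∈ᵥ proj₁ Q) →
                  (∀ u → SubMultiset F ns (proj₂ (proj₂ P) u) (proj₂ (proj₂ Q) u)) →
                  SubMultiset F (n ∷ ns) P Q
  subMultiset-∷ {n} {ns = ns} P Q U′⊆U sub = ι , ι-injective , ι-pure
    where
    ι : Tuples F (n ∷ ns) P → Tuples F (n ∷ ns) Q
    ι (u , u∈U′ , ts) = u , U′⊆U u∈U′ , proj₁ (sub u) ts
    ι-injective : Injective _≡_ _≡_ ι
    ι-injective {u , u∈U′ , ts} {_ , u∈U′′ , _} eq
      with ≡.refl ← ≡.cong proj₁ eq with ≡.refl ← T-irrelevant u∈U′ u∈U′′ =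
      ≡.cong (λ ts → u , u∈U′ , ts) (proj₁ (proj₂ (sub u)) (≡.cong proj₂ (,-injectiveʳ eq)))
    ι-pure : ∀ t → pure F (n ∷ ns) Q (ι t) ≗ pure F (n ∷ ns) P t
    ι-pure (u , _ , ts) (q , i) = ≡.cong (lookup u q *_) (proj₂ (proj₂ (sub u)) ts i)

  record Refinement {d k N} (m : ℕ) (ns : Vec ℕ d) (Q : System F k ns) (cs : Fin N → Constraint ns) : Set where
    field
      system    : System F m ns
      ⊆Q        : SubMultiset F ns system Q
      satisfies : ∀ t j → vectorsOf ns system t ⊨ cs j

  refine : ∀ {d} k N (ns : Vec ℕ d) (Q : System F k ns) (cs : Fin N → Constraint ns) →
           Refinement (k ℕ.+ N) ns Q cs
  refine k N []       Q             cs = record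
    { system = tt ; ⊆Q = subMultiset-[] {k ℕ.+ N} {k} tt Q ; satisfies = λ _ j → ⊨-[] (cs j) }
  refine k N (n ∷ ns) (U , cw , ch) cs = record
    { system    = P
    ; ⊆Q        = subMultiset-∷ P (U , cw , ch) (proj₁ ∘ ∈⋂ker⇒ U φs) (λ u → Refinement.⊆Q (child u))
    ; satisfies = λ (u , u∈U′ , ts) j →
        ⊨-∷ (cs j) (proj₂ (∈⋂ker⇒ U φs u∈U′) j) (Refinement.satisfies (child u) ts j)
    }
    where
    φs : Fin N → Fin n → Carrier
    φs = headForm ∘ cs
    child : ∀ u → Refinement (k ℕ.+ N) ns (ch u) (specialise u ∘ cs)
    child u = refine k N ns (ch u) (specialise u ∘ cs)
    P : System F (k ℕ.+ N) (n ∷ ns)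
    P = ⋂ker U φs , ≡.subst (CodimV≤ F (⋂ker U φs)) (ℕₚ.+-comm N k) (codimV≤-⋂ker cw φs) ,
        λ u → Refinement.system (child u)

  tensorI∈ : ∀ {d} {ns : Vec ℕ d} (I : Subset d) {L : SubspaceF F (Idx F I ns)} {x y} {t : Tensor F ns} →
             SubspaceF.mem L x → t ≗ tensorI F I x y → InTensorSub F I L t
  tensorI∈ I {x = x} {y} x∈L t≗xy = [ x , x∈L , y ] , λ i → ≡.trans (t≗xy i) (≈⇒≡ (sym (+-identityʳ _)))

  module _ {d} (ns : Vec ℕ d) (l : ℕ) (L : (I : Subset d) → SubspaceF F (Idx F I ns))
           (codimL : ∀ I → Nonempty I → CodimF≤ F (L I) l) where

    annihilators : ∀ I → Nonempty I →
      Σ[ φ ∈ (Fin l → Idx F I ns → Carrier) ]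
        (∀ x → (∀ i → Summable.⟪_∣_⟫ (idxSummable I ns) (φ i) x ≈ 0#) → SubspaceF.mem (L I) x)
    annihilators I I≠∅ = codim≤⇒kernel⊆ (idxSummable I ns) {L I} (codimL I I≠∅)

    -- The decision is an argument so that ⨂∈L sees the same proof of Nonempty I that chose the forms.
    constraintFor : (I : Subset d) → Dec (Nonempty I) → Fin l → Constraint ns
    constraintFor I (yes I≠∅) i = form I I≠∅ (proj₁ (annihilators I I≠∅) i)
    constraintFor I (no _)    _ = trivial

    constraint : Subset d × Fin l → Constraint ns
    constraint (I , i) = constraintFor I (nonempty? I) i

    tensorConstraints : Fin (2 ℕ.^ d ℕ.* l) → Constraint ns
    tensorConstraints = constraint ∘ subsetAndIndex

    ⨂∈L : ∀ I (I? : Dec (Nonempty I)) us → (∀ i → us ⊨ constraintFor I I? i) → Nonempty I →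
          SubspaceF.mem (L I) (⨂ I us)
    ⨂∈L I (yes I≠∅) us sat _   = proj₂ (annihilators I I≠∅) (⨂ I us) sat
    ⨂∈L I (no I=∅)  _  _   I≠∅ = contradiction I≠∅ I=∅

    ⨂∈T : ∀ us → (∀ j → us ⊨ tensorConstraints j) → ∀ {t} → t ≗ ⨂ ⊤ us → InT F L t
    ⨂∈T us sat t≗⨂ I I≠∅ =
      tensorI∈ {ns = ns} I {L I} {y = ⨂ (∁ I) us} (⨂∈L I (nonempty? I) us satI I≠∅)
               (λ i → ≡.trans (t≗⨂ i) (≈⇒≡ (⨂⊤≈tensorI I us i)))
      where
      satI : ∀ i → us ⊨ constraintFor I (nonempty? I) i
      satI i = ≡.subst (λ Ii → us ⊨ constraint Ii) (proj₂ j) (sat (proj₁ j))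
        where j = subsetAndIndex-surjective I i

open import Data.Nat using (_+_; _*_; _^_; _≤_)

lemma2p11 : (F : FiniteField) (d : ℕ) → 1 ≤ d → (ns : Vec ℕ d) →
    (∀ (j : Fin d) → 1 ≤ lookup ns j) → (k l : ℕ) → (Q : System F k ns) →
    (L : (I : Subset d) → SubspaceF F (Idx F I ns)) →
    (∀ (I : Subset d) → Nonempty I → CodimF≤ F (L I) l) →
    Σ[ P ∈ System F (k + 2 ^ d * l) ns ]
      (SubMultiset F ns P Q × (∀ (t : Tuples F ns P) → InT F L (pure F ns P t)))
lemma2p11 F d _ ns _ k l Q L codimL = system , ⊆Q , λ t →
  ⨂∈T F ns l L codimL (vectorsOf F ns system t) (satisfies t) (pure≡⨂ F ns system t)
  where open Refinement (refine F k (2 ^ d * l) ns Q (tensorConstraints F ns l L codimL))
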